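{- Let $b\ge 2$ be an integer. (i) Every integer $u>b$ has a unique representation $u=c(b^m+1)+k$ with integers $m\ge1$, $1\le c\le b-1$, and $0\le k\le b^m$ if $c<b-1$, $0\le k\le b^m-b+1$ if $c=b-1$. (ii) Let $u=c(b^m+1)+k$ and $u'=c'(b^{m'}+1)+k'$ be integers greater than $b$ represented as in (i), and suppose $u\le u'$. Then $m\le m'$; if moreover $m=m'$ then $c\le c'$; and if $m=m'$ and $c=c'$ then $k\le k'$. -}

module Defs where

open import Data.Nat using (ℕ; _+_; _*_; _∸_; _^_; _≤_; _<_)
open import Data.Product using (_×_)
open import Data.Sum using (_⊎_)
open import Relation.Binary.PropositionalEquality using (_≡_)

Rep : (b u m c k : ℕ) → Set
Rep b u m c k =
  u ≡ c * (b ^ m + 1) + k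
  × 1 ≤ m
  × 1 ≤ c × c ≤ b ∸ 1
  × ((c < b ∸ 1 × k ≤ b ^ m) ⊎ (c ≡ b ∸ 1 × k ≤ b ^ m ∸ b + 1))

-- With B = b^m, the values
-- represented with exponent m fill exactly the block b^m < u ≤ b^(m+1), and
-- inside it the leading digit c fills the block c(B+1) ≤ u < (c+1)(B+1), so
-- c = u / (B+1) and k = u % (B+1). An element of a family of consecutive
-- blocks indexed monotonically determines its index monotonically, which
-- gives (ii); uniqueness in (i) is (ii) applied in both directions, and
-- existence locates the block of b-powers containing u and then divides.
module Submission where

open import Defs
open import Data.Nat using (ℕ; zero; suc; _+_; _*_; _∸_; _^_; _≤_; _<_; z≤n; s≤s; NonZero; >-nonZero; >-nonZero⁻¹; _<?_)
open import Data.Nat.Properties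
open import Data.Nat.DivMod using (_/_; _%_; m≡m%n+[m/n]*n; m%n<n; m≥n⇒m/n>0; m<n*o⇒m/o<n)
open import Data.Nat.Tactic.RingSolver using (solve-∀)
open import Data.Product using (_×_; _,_; proj₁; ∃-syntax)
open import Data.Sum using (_⊎_; inj₁; inj₂)
open import Relation.Binary.Core using (_Preserves_⟶_)
open import Relation.Nullary using (yes; no; contradiction)
open import Relation.Binary.PropositionalEquality using (_≡_; refl; sym; trans; cong; subst; subst₂)

open ≤-Reasoning

InBlock : (ℕ → ℕ) → ℕ → ℕ → Set
InBlock l i x = l i ≤ x × x < l (suc i)

InBlock-index-mono : ∀ {l i j x y} → l Preserves _≤_ ⟶ _≤_ →
  InBlock l i x → InBlock l j y → x ≤ y → i ≤ j
InBlock-index-mono {l} {i} {j} {x} {y} l-mono (li≤x , _) (_ , y<lj+1) x≤y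
  with suc j ≤? i
... | no j≮i = ≮⇒≥ j≮i
... | yes j<i = contradiction y<lj+1 (≤⇒≯ (begin
  l (suc j) ≤⟨ l-mono j<i ⟩
  l i       ≤⟨ li≤x ⟩
  x         ≤⟨ x≤y ⟩
  y         ∎))

∃-crossing : (f : ℕ → ℕ) {u : ℕ} → f 0 < u → ∀ n → u ≤ f n →
  ∃[ m ] f m < u × u ≤ f (suc m)
∃-crossing f f0<u zero    u≤f0 = contradiction f0<u (≤⇒≯ u≤f0)
∃-crossing f {u} f0<u (suc n) u≤fn+1 with f n <? u
... | yes fn<u = n , fn<u , u≤fn+1
... | no  fn≮u = ∃-crossing f f0<u n (≮⇒≥ fn≮u)

n<m^n : ∀ {m} → 1 < m → ∀ n → n < m ^ n
n<m^n 1<m zero    = s≤s z≤n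
n<m^n {m@(suc _)} 1<m (suc n) = ≤-trans (s≤s (n<m^n 1<m n)) (^-monoʳ-< m 1<m (n<1+n n))

m≤m^n : ∀ m {n} .{{_ : NonZero m}} → 1 ≤ n → m ≤ m ^ n
m≤m^n m {n} 1≤n = begin
  m      ≡⟨ *-identityʳ m ⟨
  m ^ 1  ≤⟨ ^-monoʳ-≤ m 1≤n ⟩
  m ^ n  ∎

top-digit-max : ∀ {b B} → 1 ≤ b → b ≤ B → (b ∸ 1) * (B + 1) + (B ∸ b + 1) ≡ b * B
top-digit-max {suc b₁} _ b≤B with m≤n⇒∃[o]m+o≡n b≤B
... | d , refl rewrite m+n∸m≡n (suc b₁) d = identity b₁ d
  where
  identity : ∀ b₁ d → b₁ * (1 + b₁ + d + 1) + (d + 1) ≡ (1 + b₁) * (1 + b₁ + d)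
  identity = solve-∀

lower-digit-max : ∀ {b B c} → c < b ∸ 1 → b ≤ B → c * (B + 1) + B ≤ b * B
lower-digit-max {suc b₁} {B} {c} c<b₁ b≤B with m≤n⇒∃[o]m+o≡n c<b₁ | m≤n⇒∃[o]m+o≡n b≤B
... | e , refl | f , refl = m+n≤o⇒m≤o _ (≤-reflexive (identity c e f))
  where
  -- the slack term makes both sides polynomials without subtraction
  identity : ∀ c e f → c * (suc (suc c + e) + f + 1) + (suc (suc c + e) + f)
               + (2 + e + f + e * (suc (suc c + e) + f))
               ≡ suc (suc c + e) * (suc (suc c + e) + f)
  identity = solve-∀

Rep⇒1<b : ∀ {b u m c k} → Rep b u m c k → 1 < b
Rep⇒1<b {0}           (_ , _ , 1≤c , c≤0 , _) = contradiction (≤-trans 1≤c c≤0) λ ()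
Rep⇒1<b {1}           (_ , _ , 1≤c , c≤0 , _) = contradiction (≤-trans 1≤c c≤0) λ ()
Rep⇒1<b {suc (suc _)} _                       = s≤s (s≤s z≤n)

Rep⇒b≢0 : ∀ {b u m c k} → Rep b u m c k → NonZero b
Rep⇒b≢0 R = >-nonZero (<-trans (s≤s z≤n) (Rep⇒1<b R))

Rep⇒b≤b^m : ∀ {b u m c k} → Rep b u m c k → b ≤ b ^ m
Rep⇒b≤b^m {b} R@(_ , 1≤m , _) = m≤m^n b {{Rep⇒b≢0 R}} 1≤m

Rep⇒k≤b^m : ∀ {b u m c k} → Rep b u m c k → k ≤ b ^ m
Rep⇒k≤b^m (_ , _ , _ , _ , inj₁ (_ , k≤B)) = k≤B
Rep⇒k≤b^m {b} {m = m} {k = k} R@(_ , _ , _ , _ , inj₂ (_ , k≤B∸b+1)) = begin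
  k              ≤⟨ k≤B∸b+1 ⟩
  b ^ m ∸ b + 1  ≤⟨ +-monoˡ-≤ 1 (∸-monoʳ-≤ (b ^ m) 1≤b) ⟩
  b ^ m ∸ 1 + 1  ≡⟨ m∸n+n≡m (≤-trans 1≤b (Rep⇒b≤b^m R)) ⟩
  b ^ m          ∎
  where
  1≤b = <⇒≤ (Rep⇒1<b R)

Rep⇒digit-block : ∀ {b u m c k} → Rep b u m c k → InBlock (_* (b ^ m + 1)) c u
Rep⇒digit-block {b} {m = m} {c} {k} R@(refl , _) = m≤m+n (c * N) k , (begin-strict
  c * N + k            <⟨ +-monoʳ-< (c * N) (s≤s (Rep⇒k≤b^m R)) ⟩
  c * N + suc (b ^ m)  ≡⟨ cong (c * N +_) (+-comm 1 (b ^ m)) ⟩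
  c * N + N            ≡⟨ +-comm (c * N) N ⟩
  suc c * N            ∎)
  where
  N = b ^ m + 1

Rep⇒≤b^[m+1] : ∀ {b u m c k} → Rep b u m c k → u ≤ b ^ suc m
Rep⇒≤b^[m+1] {b} {m = m} {c} {k} R@(refl , _ , _ , _ , inj₁ (c<b-1 , k≤B)) = begin
  c * (b ^ m + 1) + k      ≤⟨ +-monoʳ-≤ (c * (b ^ m + 1)) k≤B ⟩
  c * (b ^ m + 1) + b ^ m  ≤⟨ lower-digit-max c<b-1 (Rep⇒b≤b^m R) ⟩
  b * b ^ m                ∎
Rep⇒≤b^[m+1] {b} {m = m} {k = k} R@(refl , _ , _ , _ , inj₂ (refl , k≤B∸b+1)) = begin
  (b ∸ 1) * N + k              ≤⟨ +-monoʳ-≤ ((b ∸ 1) * N) k≤B∸b+1 ⟩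
  (b ∸ 1) * N + (b ^ m ∸ b + 1) ≡⟨ top-digit-max (<⇒≤ (Rep⇒1<b R)) (Rep⇒b≤b^m R) ⟩
  b * b ^ m                     ∎
  where
  N = b ^ m + 1

Rep⇒scale-block : ∀ {b u m c k} → Rep b u m c k → InBlock (λ i → suc (b ^ i)) m u
Rep⇒scale-block {b} {u} {m} {c} R@(_ , _ , 1≤c , _) = (begin
  suc (b ^ m)  ≡⟨ +-comm 1 (b ^ m) ⟩
  N            ≡⟨ *-identityˡ N ⟨
  1 * N        ≤⟨ *-monoˡ-≤ N 1≤c ⟩
  c * N        ≤⟨ proj₁ (Rep⇒digit-block R) ⟩
  u            ∎) , s≤s (Rep⇒≤b^[m+1] R)
  where
  N = b ^ m + 1

Rep-mono : ∀ {b u u′ m c k m′ c′ k′} → Rep b u m c k → Rep b u′ m′ c′ k′ → u ≤ u′ →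
  m ≤ m′ × (m ≡ m′ → c ≤ c′) × (m ≡ m′ → c ≡ c′ → k ≤ k′)
Rep-mono {b} {m = m} {c} {k} {k′ = k′} R R′ u≤u′ = m≤m′ , c≤c′ , k≤k′
  where
  instance
    b≢0 : NonZero b
    b≢0 = Rep⇒b≢0 R

  m≤m′ : m ≤ _
  m≤m′ = InBlock-index-mono (λ i≤j → s≤s (^-monoʳ-≤ b i≤j))
           (Rep⇒scale-block R) (Rep⇒scale-block R′) u≤u′

  c≤c′ : m ≡ _ → c ≤ _
  c≤c′ refl = InBlock-index-mono (*-monoˡ-≤ (b ^ m + 1))
                (Rep⇒digit-block R) (Rep⇒digit-block R′) u≤u′

  k≤k′ : m ≡ _ → c ≡ _ → k ≤ k′
  k≤k′ refl refl = +-cancelˡ-≤ (c * (b ^ m + 1)) k k′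
                     (subst₂ _≤_ (proj₁ R) (proj₁ R′) u≤u′)

Rep-unique : ∀ {b u m c k m′ c′ k′} → Rep b u m c k → Rep b u m′ c′ k′ →
  m ≡ m′ × c ≡ c′ × k ≡ k′
Rep-unique R R′ with Rep-mono R R′ ≤-refl | Rep-mono R′ R ≤-refl
... | m≤m′ , c≤c′ , k≤k′ | m′≤m , c′≤c , k′≤k =
  m≡m′ , c≡c′ , ≤-antisym (k≤k′ m≡m′ c≡c′) (k′≤k (sym m≡m′) (sym c≡c′))
  where
  m≡m′ = ≤-antisym m≤m′ m′≤m
  c≡c′ = ≤-antisym (c≤c′ m≡m′) (c′≤c (sym m≡m′))

∃-scale : ∀ {b u} → 1 < b → b < u → ∃[ m ] 1 ≤ m × b ^ m < u × u ≤ b ^ suc m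
∃-scale {b} {u} 1<b b<u
  with ∃-crossing (λ i → b ^ suc i) (subst (_< u) (sym (*-identityʳ b)) b<u) u
         (<⇒≤ (<-trans (n<m^n 1<b u) (^-monoʳ-< b 1<b (n<1+n u))))
... | m , b^[m+1]<u , u≤b^[m+2] = suc m , s≤s z≤n , b^[m+1]<u , u≤b^[m+2]

Rep-exists : ∀ {b u} → 2 ≤ b → b < u → ∃[ m ] ∃[ c ] ∃[ k ] Rep b u m c k
Rep-exists {b@(suc b₁)} {u} 2≤b b<u with ∃-scale 2≤b b<u
... | m , 1≤m , b^m<u , u≤b^[m+1] =
  m , c , k , u≡cN+k , 1≤m , 1≤c , c≤b₁ , leading-digit-cases
  where
  B = b ^ m
  N = B + 1
  instance
    N≢0 : NonZero N
    N≢0 = subst NonZero (+-comm 1 B) _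
  c = u / N
  k = u % N

  u≡cN+k : u ≡ c * N + k
  u≡cN+k = trans (m≡m%n+[m/n]*n u N) (+-comm k (c * N))

  1≤c : 1 ≤ c
  1≤c = m≥n⇒m/n>0 (subst (_≤ u) (+-comm 1 B) b^m<u)

  c≤b₁ : c ≤ b₁
  c≤b₁ = m<1+n⇒m≤n (m<n*o⇒m/o<n (begin-strict
    u              ≤⟨ u≤b^[m+1] ⟩
    b * B          <⟨ m<m+n (b * B) (s≤s z≤n) ⟩
    b * B + b      ≡⟨ cong (b * B +_) (*-identityʳ b) ⟨
    b * B + b * 1  ≡⟨ *-distribˡ-+ b B 1 ⟨
    b * N          ∎))

  leading-digit-cases : (c < b₁ × k ≤ B) ⊎ (c ≡ b₁ × k ≤ B ∸ b + 1)
  leading-digit-cases with m≤n⇒m<n∨m≡n c≤b₁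
  ... | inj₁ c<b₁ = inj₁ (c<b₁ , m<1+n⇒m≤n (subst (k <_) (+-comm B 1) (m%n<n u N)))
  ... | inj₂ c≡b₁ = inj₂ (c≡b₁ , +-cancelˡ-≤ (b₁ * N) k (B ∸ b + 1) (begin
    b₁ * N + k             ≡⟨ cong (λ d → d * N + k) c≡b₁ ⟨
    c * N + k              ≡⟨ u≡cN+k ⟨
    u                      ≤⟨ u≤b^[m+1] ⟩
    b * B                  ≡⟨ top-digit-max (s≤s z≤n) (m≤m^n b 1≤m) ⟨
    b₁ * N + (B ∸ b + 1)   ∎))

lemma2p5 : (b : ℕ) → 2 ≤ b →
    ((u : ℕ) → b < u →
      (∃[ m ] ∃[ c ] ∃[ k ] Rep b u m c k)
      × (∀ m c k m′ c′ k′ → Rep b u m c k → Rep b u m′ c′ k′ →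
           m ≡ m′ × c ≡ c′ × k ≡ k′))
    ×
    (∀ u u′ m c k m′ c′ k′ → b < u → b < u′ →
      Rep b u m c k → Rep b u′ m′ c′ k′ → u ≤ u′ →
        m ≤ m′ × (m ≡ m′ → c ≤ c′) × (m ≡ m′ → c ≡ c′ → k ≤ k′))
lemma2p5 b 2≤b =
  (λ u b<u → Rep-exists 2≤b b<u , λ _ _ _ _ _ _ → Rep-unique) ,
  (λ _ _ _ _ _ _ _ _ _ _ → Rep-mono)
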